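{- Let $l\geq 3$ be an integer and let $H$ be a $3$-uniform hypergraph. Then the set $E_{\text{light}}(H)$ of light edges of $H$ is the union of the edge sets of at most $6l-11$ simple hypergraphs.
   Context: Fix $l\geq 3$. For a 3-uniform hypergraph $H$, a pair of vertices is heavy in $H$ if it is contained in at least $2l-2$ edges of $H$, and light otherwise. An edge of $H$ is light if none of the three pairs it contains is heavy in $H$; $E_{\text{light}}(H)$ denotes the set of light edges. A hypergraph is simple if any two distinct edges share at most one vertex. -}

module Defs where

open import Data.Nat using (ℕ; _≤_; _<_; _∸_; _*_)
open import Data.Fin using (Fin)
import Data.Fin as F
open import Data.Fin.Properties using (_≟_)
open import Data.Bool using (Bool; T; _∧_; _∨_)
open import Data.Product using (_×_; _,_; ∃-syntax)
open import Data.List using (List; length; filter; allFin; cartesianProduct)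
open import Relation.Nullary using (¬_)
open import Relation.Nullary.Decidable using (⌊_⌋)
open import Relation.Binary.PropositionalEquality using (_≡_)
open import Data.Sum using (_⊎_)

Triple : ℕ → Set
Triple n = Fin n × Fin n × Fin n

-- A finite 3-uniform hypergraph on vertex set Fin n. Each 3-element edge
-- {a,b,c} is represented uniquely by its increasing listing a < b < c.
record Hypergraph3 (n : ℕ) : Set where
  field
    edge : Triple n → Bool
    increasing : ∀ a b c → T (edge (a , b , c)) → (a F.< b) × (b F.< c)
open Hypergraph3 public

IsEdge : ∀ {n} → Hypergraph3 n → Triple n → Set
IsEdge H t = T (edge H t)

_∈ᵗ_ : ∀ {n} → Fin n → Triple n → Set
u ∈ᵗ (a , b , c) = (u ≡ a) ⊎ (u ≡ b) ⊎ (u ≡ c)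

∈ᵗ? : ∀ {n} → Fin n → Triple n → Bool
∈ᵗ? u (a , b , c) = ⌊ u ≟ a ⌋ ∨ ⌊ u ≟ b ⌋ ∨ ⌊ u ≟ c ⌋

allTriples : ∀ n → List (Triple n)
allTriples n = cartesianProduct (allFin n) (cartesianProduct (allFin n) (allFin n))

codeg : ∀ {n} → Hypergraph3 n → Fin n → Fin n → ℕ
codeg H u v = length (filter (λ t → T? (edge H t ∧ ∈ᵗ? u t ∧ ∈ᵗ? v t)) (allTriples _))
  where
  open import Data.Bool.Properties using () renaming (T? to T?)

Heavy : ∀ {n} → ℕ → Hypergraph3 n → Fin n → Fin n → Set
Heavy l H u v = 2 * l ∸ 2 ≤ codeg H u v

LightEdge : ∀ {n} → ℕ → Hypergraph3 n → Triple n → Set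
LightEdge l H (a , b , c) =
  IsEdge H (a , b , c) × ¬ Heavy l H a b × ¬ Heavy l H a c × ¬ Heavy l H b c

Simple : ∀ {n} → Hypergraph3 n → Set
Simple H = ∀ e f → IsEdge H e → IsEdge H f → ¬ (e ≡ f) →
  ∀ u v → u ∈ᵗ e → v ∈ᵗ e → u ∈ᵗ f → v ∈ᵗ f → u ≡ v

-- Call two light edges conflicting if they are distinct and share a pair of
-- vertices. A light edge e lies with each of its three pairs in at most
-- 2l-3 edges, so at most 3(2l-4) = 6l-12 edges conflict with e. Greedily
-- colouring the conflict graph with 6l-11 colours makes every colour class a
-- set of light edges pairwise sharing at most one vertex, i.e. a simple
-- hypergraph, and the colour classes together cover exactly the light edges.
module Submission where

open import Defs
open import Data.Nat using (ℕ; suc; _+_; _*_; _∸_; _≤_; _<_; s≤s; z≤n)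
open import Data.Nat.Properties
  using (≤-refl; ≤-reflexive; ≤-pred; <⇒≱; ≰⇒>; +-mono-≤; _≤?_; module ≤-Reasoning)
open import Data.Nat.Tactic.RingSolver using (solve-∀)
open import Data.Fin using (Fin; fromℕ<)
open import Data.Fin.Properties using (¬∀⟶∃¬; injective⇒≤)
import Data.Fin.Properties as Fin
open import Data.Product using (Σ; ∃; ∃-syntax; _×_; _,_; proj₁; proj₂)
open import Data.Product.Properties using (≡-dec)
open import Data.Sum using (inj₁; inj₂)
import Data.Sum as Sum
open import Data.List using (List; []; _∷_; _++_; map; length; filter)
open import Data.List.Properties using (length-map; length-++; filter-notAll)
open import Data.List.Membership.Propositional using (_∈_; _∉_)
open import Data.List.Membership.Propositional.Properties
  using (∈-map⁺; ∈-++⁺ˡ; ∈-++⁺ʳ; ∈-filter⁺; ∈-cartesianProduct⁺; ∈-allFin)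
open import Data.List.Membership.DecPropositional using (_∈?_)
open import Data.List.Membership.Setoid.Properties using (index-injective)
open import Data.List.Relation.Unary.Any using (here; there)
import Data.List.Relation.Unary.Any as Any
open import Data.Bool using (T; _∧_)
open import Data.Bool.Properties using (T-∧; T-∨; T?)
open import Relation.Nullary using (¬_; Dec; yes; no; ¬?; contradiction)
open import Relation.Nullary.Decidable using (⌊_⌋; fromWitness; toWitness; _×-dec_)
open import Relation.Binary using (Symmetric; DecidableEquality)
open import Relation.Binary.PropositionalEquality using (_≡_; _≢_; refl; sym; trans; cong; subst; setoid)
open import Function.Bundles using (_⇔_; mk⇔; Equivalence)
open import Function.Base using (_∘_)

∃∉-of-length< : ∀ {K} (xs : List (Fin K)) → length xs < K → ∃ λ c → c ∉ xs
∃∉-of-length< {K} xs |xs|<K = ¬∀⟶∃¬ K (_∈ xs) (λ c → _∈?_ Fin._≟_ c xs) ¬all∈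
  where
  ¬all∈ : ¬ (∀ c → c ∈ xs)
  ¬all∈ all∈ = <⇒≱ |xs|<K (injective⇒≤ (index-injective (setoid (Fin K)) (all∈ _) (all∈ _)))

module GreedyColouring
  {A : Set} (_≟_ : DecidableEquality A)
  (_~_ : A → A → Set) (~-sym : Symmetric _~_) (~-irrefl : ∀ {x} → ¬ x ~ x)
  {D K : ℕ} (D<K : D < K) (neighbours : A → List A)
  (neighbours-length : ∀ x → length (neighbours x) ≤ D)
  (neighbours-complete : ∀ {x y} → x ~ y → y ∈ neighbours x)
  where

  Proper : List A → (A → Fin K) → Set
  Proper V c = ∀ {u v} → u ∈ V → v ∈ V → u ~ v → c u ≢ c v

  _[_≔_] : (A → Fin K) → A → Fin K → A → Fin K
  (c [ x ≔ k ]) y with y ≟ x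
  ... | yes _ = k
  ... | no _ = c y

  free-colour : (c : A → Fin K) (x : A) → ∃ λ k → k ∉ map c (neighbours x)
  free-colour c x = ∃∉-of-length< (map c (neighbours x)) (begin-strict
    length (map c (neighbours x)) ≡⟨ length-map c (neighbours x) ⟩
    length (neighbours x)         ≤⟨ neighbours-length x ⟩
    D                             <⟨ D<K ⟩
    K                             ∎)
    where open ≤-Reasoning

  fresh-differs : ∀ {c : A → Fin K} {x k v} → k ∉ map c (neighbours x) → x ~ v → k ≢ c v
  fresh-differs {c} k-free x~v k≡cv =
    k-free (subst (_∈ map c _) (sym k≡cv) (∈-map⁺ c (neighbours-complete x~v)))

  extend-proper : ∀ {V c x k} → Proper V c → k ∉ map c (neighbours x) →
                  Proper (x ∷ V) (c [ x ≔ k ])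
  extend-proper {V} {x = x} c-proper k-free {u} {v} u∈ v∈ u~v with u ≟ x | v ≟ x
  ... | yes refl | yes refl = λ _ → ~-irrefl u~v
  ... | yes refl | no _     = fresh-differs k-free u~v
  ... | no _     | yes refl = fresh-differs k-free (~-sym u~v) ∘ sym
  ... | no u≢x   | no v≢x   = c-proper (tail u∈ u≢x) (tail v∈ v≢x) u~v
    where
    tail : ∀ {w} → w ∈ x ∷ V → w ≢ x → w ∈ V
    tail (here w≡x) w≢x = contradiction w≡x w≢x
    tail (there w∈) _   = w∈

  colouring : (V : List A) → Σ (A → Fin K) (Proper V)
  colouring [] = (λ _ → fromℕ< D<K) , λ ()
  colouring (x ∷ V) with colouring V
  ... | c , c-proper with free-colour c x
  ... | k , k-free = c [ x ≔ k ] , extend-proper c-proper k-free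

pairs-of-triple : ∀ {n} (P : Fin n → Fin n → Set) → (∀ {x y} → P x y → P y x) →
                  ∀ {a b c} → P a b → P a c → P b c →
                  ∀ {u v} → u ≢ v → u ∈ᵗ (a , b , c) → v ∈ᵗ (a , b , c) → P u v
pairs-of-triple _ _ _ _ _ u≢v (inj₁ refl)        (inj₁ refl)        = contradiction refl u≢v
pairs-of-triple _ _ pab _ _ _ (inj₁ refl)        (inj₂ (inj₁ refl)) = pab
pairs-of-triple _ _ _ pac _ _ (inj₁ refl)        (inj₂ (inj₂ refl)) = pac
pairs-of-triple _ P-sym pab _ _ _ (inj₂ (inj₁ refl)) (inj₁ refl)        = P-sym pab
pairs-of-triple _ _ _ _ _ u≢v (inj₂ (inj₁ refl)) (inj₂ (inj₁ refl)) = contradiction refl u≢v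
pairs-of-triple _ _ _ _ pbc _ (inj₂ (inj₁ refl)) (inj₂ (inj₂ refl)) = pbc
pairs-of-triple _ P-sym _ pac _ _ (inj₂ (inj₂ refl)) (inj₁ refl)        = P-sym pac
pairs-of-triple _ P-sym _ _ pbc _ (inj₂ (inj₂ refl)) (inj₂ (inj₁ refl)) = P-sym pbc
pairs-of-triple _ _ _ _ _ u≢v (inj₂ (inj₂ refl)) (inj₂ (inj₂ refl)) = contradiction refl u≢v

_≟ᵗ_ : ∀ {n} → DecidableEquality (Triple n)
_≟ᵗ_ = ≡-dec Fin._≟_ (≡-dec Fin._≟_ Fin._≟_)

∈ᵗ⇒∈ᵗ? : ∀ {n} {u : Fin n} t → u ∈ᵗ t → T (∈ᵗ? u t)
∈ᵗ⇒∈ᵗ? {u = u} (a , b , c) =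
  Equivalence.from (T-∨ {⌊ u Fin.≟ a ⌋}) ∘ Sum.map fromWitness
    (Equivalence.from (T-∨ {⌊ u Fin.≟ b ⌋}) ∘ Sum.map fromWitness fromWitness)

∈-allTriples : ∀ {n} (t : Triple n) → t ∈ allTriples n
∈-allTriples (a , b , c) =
  ∈-cartesianProduct⁺ (∈-allFin a) (∈-cartesianProduct⁺ (∈-allFin b) (∈-allFin c))

SharePair : ∀ {n} → Triple n → Triple n → Set
SharePair e f = ∃ λ u → ∃ λ v → u ≢ v × u ∈ᵗ e × v ∈ᵗ e × u ∈ᵗ f × v ∈ᵗ f

module _ {n : ℕ} (H : Hypergraph3 n) where

  edgesThrough : Fin n → Fin n → List (Triple n)
  edgesThrough u v = filter (λ t → T? (edge H t ∧ ∈ᵗ? u t ∧ ∈ᵗ? v t)) (allTriples n)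

  ∈-edgesThrough : ∀ {u v t} → IsEdge H t → u ∈ᵗ t → v ∈ᵗ t → t ∈ edgesThrough u v
  ∈-edgesThrough {t = t} t∈H u∈t v∈t = ∈-filter⁺ _ (∈-allTriples t)
    (Equivalence.from T-∧ (t∈H , Equivalence.from T-∧ (∈ᵗ⇒∈ᵗ? t u∈t , ∈ᵗ⇒∈ᵗ? t v∈t)))

  edgesThroughOtherThan : Triple n → Fin n → Fin n → List (Triple n)
  edgesThroughOtherThan e u v = filter (λ f → ¬? (f ≟ᵗ e)) (edgesThrough u v)

  ∈-edgesThroughOtherThan : ∀ {e u v f} → IsEdge H f → f ≢ e → u ∈ᵗ f → v ∈ᵗ f →
                            f ∈ edgesThroughOtherThan e u v
  ∈-edgesThroughOtherThan f∈H f≢e u∈f v∈f = ∈-filter⁺ _ (∈-edgesThrough f∈H u∈f v∈f) f≢e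

  length-edgesThroughOtherThan< : ∀ {e u v} → IsEdge H e → u ∈ᵗ e → v ∈ᵗ e →
                                  length (edgesThroughOtherThan e u v) < codeg H u v
  length-edgesThroughOtherThan< e∈H u∈e v∈e = filter-notAll _ _
    (Any.map (λ e≡f f≢e → f≢e (sym e≡f)) (∈-edgesThrough e∈H u∈e v∈e))

  edgesSharingPairWith : Triple n → List (Triple n)
  edgesSharingPairWith e@(a , b , c) =
    edgesThroughOtherThan e a b ++ edgesThroughOtherThan e a c ++ edgesThroughOtherThan e b c

  ∈-edgesSharingPairWith : ∀ {e f} → IsEdge H f → f ≢ e → SharePair e f → f ∈ edgesSharingPairWith e
  ∈-edgesSharingPairWith {e@(a , b , c)} {f} f∈H f≢e (u , v , u≢v , u∈e , v∈e , u∈f , v∈f) =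
    pairs-of-triple Listed (λ listed y∈f x∈f → listed x∈f y∈f)
      (λ a∈f b∈f → ∈-++⁺ˡ (through a∈f b∈f))
      (λ a∈f c∈f → ∈-++⁺ʳ ab (∈-++⁺ˡ (through a∈f c∈f)))
      (λ b∈f c∈f → ∈-++⁺ʳ ab (∈-++⁺ʳ ac (through b∈f c∈f)))
      u≢v u∈e v∈e u∈f v∈f
    where
    ab ac : List (Triple n)
    ab = edgesThroughOtherThan e a b
    ac = edgesThroughOtherThan e a c
    through : ∀ {x y} → x ∈ᵗ f → y ∈ᵗ f → f ∈ edgesThroughOtherThan e x y
    through = ∈-edgesThroughOtherThan f∈H f≢e
    Listed : Fin n → Fin n → Set
    Listed x y = x ∈ᵗ f → y ∈ᵗ f → f ∈ edgesSharingPairWith e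

module LightConflicts (l : ℕ) {n : ℕ} (H : Hypergraph3 n) where

  lightEdge? : ∀ t → Dec (LightEdge l H t)
  lightEdge? (a , b , c) = T? (edge H (a , b , c)) ×-dec ¬? (heavy? a b) ×-dec ¬? (heavy? a c) ×-dec ¬? (heavy? b c)
    where
    heavy? : ∀ u v → Dec (Heavy l H u v)
    heavy? u v = 2 * l ∸ 2 ≤? codeg H u v

  lightEdge⇒edge : ∀ {t} → LightEdge l H t → IsEdge H t
  lightEdge⇒edge {a , b , c} = proj₁

  Conflict : Triple n → Triple n → Set
  Conflict e f = LightEdge l H e × LightEdge l H f × e ≢ f × SharePair e f

  conflict-sym : Symmetric Conflict
  conflict-sym (e-light , f-light , e≢f , u , v , u≢v , u∈e , v∈e , u∈f , v∈f) =
    f-light , e-light , e≢f ∘ sym , u , v , u≢v , u∈f , v∈f , u∈e , v∈e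

  conflict-irrefl : ∀ {e} → ¬ Conflict e e
  conflict-irrefl (_ , _ , e≢e , _) = e≢e refl

  conflicts : Triple n → List (Triple n)
  conflicts e with lightEdge? e
  ... | yes _ = edgesSharingPairWith H e
  ... | no _  = []

  conflicts-complete : ∀ {e f} → Conflict e f → f ∈ conflicts e
  conflicts-complete {e} (e-light , f-light , e≢f , share) with lightEdge? e
  ... | yes _     = ∈-edgesSharingPairWith H (lightEdge⇒edge f-light) (e≢f ∘ sym) share
  ... | no ¬light = contradiction e-light ¬light

  module _ {K : ℕ} (colour : Triple n → Fin K) where

    colourClass : Fin K → Hypergraph3 n
    colourClass i = record
      { edge = λ t → ⌊ lightEdge? t ×-dec colour t Fin.≟ i ⌋
      ; increasing = λ a b c t∈ → increasing H a b c (lightEdge⇒edge (proj₁ (toWitness t∈)))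
      }

    light⇔coloured : ∀ t → LightEdge l H t ⇔ (∃[ i ] IsEdge (colourClass i) t)
    light⇔coloured t = mk⇔ (λ t-light → colour t , fromWitness (t-light , refl))
                           (λ (i , t∈) → proj₁ (toWitness t∈))

    colourClass-simple : (∀ {e f} → Conflict e f → colour e ≢ colour f) → ∀ i → Simple (colourClass i)
    colourClass-simple proper i e f e∈ f∈ e≢f u v u∈e v∈e u∈f v∈f
      with toWitness e∈ | toWitness f∈ | u Fin.≟ v
    ... | _ | _ | yes u≡v = u≡v
    ... | e-light , e-colour | f-light , f-colour | no u≢v =
      contradiction (trans e-colour (sym f-colour))
        (proper (e-light , f-light , e≢f , u , v , u≢v , u∈e , v∈e , u∈f , v∈f))

light-pair-slack : ∀ m {x c} → x < c → c < 2 * (3 + m) ∸ 2 → x ≤ 2 + 2 * m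
light-pair-slack m {x} {c} x<c c<2l∸2 = ≤-pred (≤-pred (begin
  2 + x           ≤⟨ s≤s x<c ⟩
  suc c           ≤⟨ c<2l∸2 ⟩
  2 * (3 + m) ∸ 2 ≡⟨ cong (_∸ 2) (2l≡2+[4+2m] m) ⟩
  4 + 2 * m       ∎))
  where
  open ≤-Reasoning
  2l≡2+[4+2m] : ∀ m → 2 * (3 + m) ≡ 2 + (4 + 2 * m)
  2l≡2+[4+2m] = solve-∀

6+6m<6l∸11 : ∀ m → 6 + 6 * m < 6 * (3 + m) ∸ 11
6+6m<6l∸11 m = ≤-reflexive (sym (cong (_∸ 11) (6l≡11+[7+6m] m)))
  where
  6l≡11+[7+6m] : ∀ m → 6 * (3 + m) ≡ 11 + (7 + 6 * m)
  6l≡11+[7+6m] = solve-∀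

conflicts-length : ∀ m {n} (H : Hypergraph3 n) e → length (LightConflicts.conflicts (3 + m) H e) ≤ 6 + 6 * m
conflicts-length m {n} H e@(a , b , c) with LightConflicts.lightEdge? (3 + m) H e
... | no _ = z≤n
... | yes (e∈H , ¬ab-heavy , ¬ac-heavy , ¬bc-heavy) = begin
  length (edgesSharingPairWith H e)   ≡⟨⟩
  length (ab ++ ac ++ bc)             ≡⟨ length-++ ab ⟩
  length ab + length (ac ++ bc)       ≡⟨ cong (length ab +_) (length-++ ac) ⟩
  length ab + (length ac + length bc) ≤⟨ +-mono-≤ (slack a∈e b∈e ¬ab-heavy)
                                          (+-mono-≤ (slack a∈e c∈e ¬ac-heavy) (slack b∈e c∈e ¬bc-heavy)) ⟩
  (2 + 2 * m) + ((2 + 2 * m) + (2 + 2 * m)) ≡⟨ three-slacks m ⟩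
  6 + 6 * m                           ∎
  where
  open ≤-Reasoning
  ab ac bc : List (Triple n)
  ab = edgesThroughOtherThan H e a b
  ac = edgesThroughOtherThan H e a c
  bc = edgesThroughOtherThan H e b c
  a∈e : a ∈ᵗ e
  a∈e = inj₁ refl
  b∈e : b ∈ᵗ e
  b∈e = inj₂ (inj₁ refl)
  c∈e : c ∈ᵗ e
  c∈e = inj₂ (inj₂ refl)
  slack : ∀ {u v} → u ∈ᵗ e → v ∈ᵗ e → ¬ Heavy (3 + m) H u v →
          length (edgesThroughOtherThan H e u v) ≤ 2 + 2 * m
  slack u∈e v∈e ¬heavy = light-pair-slack m (length-edgesThroughOtherThan< H e∈H u∈e v∈e) (≰⇒> ¬heavy)
  three-slacks : ∀ m → (2 + 2 * m) + ((2 + 2 * m) + (2 + 2 * m)) ≡ 6 + 6 * m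
  three-slacks = solve-∀

lemma3p6 : (l : ℕ) → 3 ≤ l → (n : ℕ) → (H : Hypergraph3 n) →
    ∃[ k ] (k ≤ 6 * l ∸ 11) × Σ (Fin k → Hypergraph3 n) (λ G →
    (∀ i → Simple (G i)) × (∀ t → LightEdge l H t ⇔ (∃[ i ] IsEdge (G i) t)))
lemma3p6 l@(suc (suc (suc m))) (s≤s (s≤s (s≤s _))) n H =
  6 * l ∸ 11 , ≤-refl , colourClass colour , colourClass-simple colour proper , light⇔coloured colour
  where
  open LightConflicts l H
  open GreedyColouring _≟ᵗ_ Conflict conflict-sym conflict-irrefl (6+6m<6l∸11 m)
         conflicts (conflicts-length m H) conflicts-complete
  colour : Triple n → Fin (6 * l ∸ 11)
  colour = proj₁ (colouring (allTriples n))
  proper : ∀ {e f} → Conflict e f → colour e ≢ colour f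
  proper = proj₂ (colouring (allTriples n)) (∈-allTriples _) (∈-allTriples _)
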